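{- Let $T$ be a bipartite tournament and $M\subseteq V(T)$. If $T$ is $M$-consistent, then $T$ has a unique $M$-sequence.
   Context: A bipartite tournament is a directed graph whose vertex set is partitioned into two sets $A,B$ such that every pair $a\in A$, $b\in B$ is joined by exactly one arc and there are no arcs inside $A$ or inside $B$. $N^+(v)$, $N^-(v)$ denote out- and in-neighbourhoods. For an acyclic bipartite tournament $D$, its canonical sequence $(V_1,V_2,\dots)$ is defined by: $V_i$ is the set of vertices with no incoming arcs in $D-\bigcup_{j<i}V_j$. $T$ is $M$-consistent if $T[M\cup\{v\}]$ is acyclic for every $v\in V(T)$. Two vertices $u,v$ are $M$-equivalent if $N^+(u)\cap M=N^+(v)\cap M$ and $N^-(u)\cap M=N^-(v)\cap M$. With $(Z_1,\dots,Z_l)$ the canonical sequence of $T[M]$: $v$ is $(M,Z_i)$-equivalent if $v$ is $M$-equivalent to some vertex of $Z_i$; $v$ is $(M,Z_i)$-conflicting if $N^+(v)\cap Z_i\neq\emptyset$, $N^-(v)\cap Z_i\neq\emptyset$, $N^+(v)\cap Z_j=\emptyset$ for all $j<i$ and $N^-(v)\cap Z_j=\emptyset$ for all $j>i$; $v$ is $M$-universal if it is not $(M,Z_i)$-equivalent for any $i$, $T[M\cup\{v\}]$ is acyclic, and some topological sort of $T[M\cup\{v\}]$ has $v$ first ($M^-$-universal) or last ($M^+$-universal). An $M$-sequence of an $M$-consistent $T$ is a sequence $(X_1,Y_1,X_2,Y_2,\dots,X_l,Y_l)$ of subsets of $V(T)$ such that for every $i$, $X_i$ is the set of all vertices of $V(T)$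 that are $(M,Z_i)$-equivalent and $Y_i$ is the set of all vertices that are $(M,Z_i)$-conflicting, and in addition $Y_1$ contains every $M^-$-universal vertex and $Y_l$ contains every $M^+$-universal vertex. -}

module Defs where

open import Data.Nat using (ℕ; zero; suc)
open import Data.Bool using (Bool; true; false)
open import Data.Fin using (Fin; toℕ; _<_)
open import Data.Fin.Subset using (Subset; _∈_; _∪_; _─_; ⁅_⁆; Empty; Nonempty)
open import Data.Vec using (Vec; []; _∷_; lookup)
open import Data.List using (List; []; _∷_; _++_; [_])
import Data.List.Membership.Propositional as LM
open import Data.List.Relation.Unary.Unique.Propositional using (Unique)
open import Data.Product using (Σ; ∃; _×_; _,_)
open import Data.Sum using (_⊎_)
open import Relation.Nullary using (¬_)
open import Relation.Binary.PropositionalEquality using (_≡_; _≢_)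
open import Function.Bundles using (_⇔_)

Digraph : ℕ → Set
Digraph n = Fin n → Fin n → Bool

module _ {n : ℕ} (D : Digraph n) where

  Arc : Fin n → Fin n → Set
  Arc u v = D u v ≡ true

  -- A bipartite tournament with parts A = {v | side v ≡ true},
  -- B = {v | side v ≡ false}.
  IsBipartiteTournament : (side : Fin n → Bool) → Set
  IsBipartiteTournament side =
      (∀ u v → side u ≡ side v → ¬ Arc u v)
    × (∀ u v → side u ≢ side v → (Arc u v × ¬ Arc v u) ⊎ (Arc v u × ¬ Arc u v))

  data Walk (S : Subset n) : Fin n → Fin n → Set where
    edge : ∀ {u v} → u ∈ S → v ∈ S → Arc u v → Walk S u v
    step : ∀ {u v w} → u ∈ S → Arc u v → Walk S v w → Walk S u w

  Acyclic : Subset n → Set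
  Acyclic S = ∀ v → ¬ Walk S v v

  Before : List (Fin n) → Fin n → Fin n → Set
  Before xs u v = Σ (List (Fin n)) λ ys → Σ (List (Fin n)) λ zs →
                    (xs ≡ ys ++ (u ∷ zs)) × (v LM.∈ zs)

  TopSort : Subset n → List (Fin n) → Set
  TopSort S xs = Unique xs
               × (∀ v → (v LM.∈ xs) ⇔ (v ∈ S))
               × (∀ u v → u ∈ S → v ∈ S → Arc u v → Before xs u v)

  data Canonical : Subset n → (l : ℕ) → Vec (Subset n) l → Set where
    done : ∀ {S} → Empty S → Canonical S 0 []
    next : ∀ {S Z l Zs} → Nonempty S →
           (∀ v → (v ∈ Z) ⇔ (v ∈ S × (∀ u → u ∈ S → ¬ Arc u v))) →
           Canonical (S ─ Z) l Zs →
           Canonical S (suc l) (Z ∷ Zs)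

  module _ (M : Subset n) where

    Consistent : Set
    Consistent = ∀ v → Acyclic (M ∪ ⁅ v ⁆)

    Equivalent : Fin n → Fin n → Set
    Equivalent u v = ∀ w → w ∈ M → (Arc u w ⇔ Arc v w) × (Arc w u ⇔ Arc w v)

    module _ {l : ℕ} (Z : Vec (Subset n) l) where

      ZEquivalent : Fin l → Fin n → Set
      ZEquivalent i v = ∃ λ u → u ∈ lookup Z i × Equivalent v u

      Conflicting : Fin l → Fin n → Set
      Conflicting i v =
          (∃ λ w → w ∈ lookup Z i × Arc v w)
        × (∃ λ w → w ∈ lookup Z i × Arc w v)
        × (∀ j → j < i → ∀ w → w ∈ lookup Z j → ¬ Arc v w)
        × (∀ j → i < j → ∀ w → w ∈ lookup Z j → ¬ Arc w v)

      UniversalMinus : Fin n → Set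
      UniversalMinus v =
          (∀ i → ¬ ZEquivalent i v)
        × Acyclic (M ∪ ⁅ v ⁆)
        × (∃ λ rest → TopSort (M ∪ ⁅ v ⁆) (v ∷ rest))

      UniversalPlus : Fin n → Set
      UniversalPlus v =
          (∀ i → ¬ ZEquivalent i v)
        × Acyclic (M ∪ ⁅ v ⁆)
        × (∃ λ rest → TopSort (M ∪ ⁅ v ⁆) (rest ++ [ v ]))

    -- A candidate sequence (X_1,Y_1,…,X_l,Y_l), stored as l and the
    -- two vectors (X_1,…,X_l), (Y_1,…,Y_l).
    Sequence : Set
    Sequence = Σ ℕ λ l → Vec (Subset n) l × Vec (Subset n) l

    IsMSequence : Sequence → Set
    IsMSequence (l , X , Y) = Σ (Vec (Subset n) l) λ Z →
        Canonical M l Z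
      × (∀ i v → (v ∈ lookup X i) ⇔ ZEquivalent Z i v)
      × (∀ i v → (v ∈ lookup Y i) ⇔
           (Conflicting Z i v
            ⊎ (toℕ i ≡ 0 × UniversalMinus Z v)
            ⊎ (suc (toℕ i) ≡ l × UniversalPlus Z v)))

-- The canonical sequence of the acyclic digraph T[M] exists, because a
-- nonempty acyclic digraph has a source, and it is unique, because it is
-- obtained by repeatedly deleting all sources.  Every membership condition
-- defining X_i and Y_i is decidable, so these sets exist and are determined
-- by their conditions.  The only non-local condition is M^±-universality:
-- under consistency it holds exactly when v is a source (sink) of
-- T[M ∪ {v}], since an acyclic digraph has a topological sort beginning
-- (ending) at any prescribed source (sink).

module Submission where

open import Defs
open import Data.Nat as ℕ using (ℕ; zero; suc; _+_)
import Data.Nat.Properties as ℕ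
open import Data.Bool using (Bool; true)
import Data.Bool.Properties as Bool
open import Data.Fin as Fin using (Fin; toℕ)
import Data.Fin.Properties as Fin
open import Data.Fin.Subset
  using (Subset; _∈_; _∉_; _∪_; _∩_; _─_; _-_; ⁅_⁆; _⊆_; _⊂_; Empty; Nonempty; inside; outside)
open import Data.Fin.Subset.Properties
open import Data.Fin.Subset.Induction using (⊂-wellFounded)
open import Data.Vec as Vec using (Vec; []; _∷_; lookup; tabulate)
import Data.Vec.Properties as Vec
open import Data.List using (List; []; _∷_; _++_; [_])
open import Data.List.Membership.Propositional using () renaming (_∈_ to _∈ₗ_)
open import Data.List.Membership.Propositional.Properties
  using (∈-++⁺ˡ; ∈-++⁺ʳ; ∈-++⁻; ∈-∃++)
import Data.List.Properties as List
open import Data.List.Relation.Unary.Any using (here; there)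
import Data.List.Relation.Unary.All as All
open import Data.List.Relation.Unary.AllPairs using ([]; _∷_)
open import Data.List.Relation.Unary.Unique.Propositional using (Unique)
import Data.List.Relation.Unary.Unique.Propositional.Properties as Unique
open import Data.Product using (Σ; ∃; ∃₂; _×_; _,_; proj₁; proj₂; map₂)
open import Data.Sum using (_⊎_; inj₁; inj₂; [_,_]′; swap)
open import Data.Empty using (⊥-elim)
open import Induction.WellFounded using (Acc; acc)
open import Relation.Nullary using (¬_; Dec; yes; no; contradiction)
open import Relation.Nullary.Decidable as Dec
  using (_×-dec_; _⊎-dec_; _→-dec_; ¬?)
open import Relation.Binary.PropositionalEquality
  using (_≡_; refl; sym; trans; cong; cong₂; subst; subst₂; module ≡-Reasoning)
open import Function.Base using (_∘_)
open import Function.Bundles using (_⇔_; mk⇔; Equivalence)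
open import Function.Properties.Equivalence using () renaming (trans to ⇔-trans; sym to ⇔-sym)
open Equivalence using (to; from)

private
  variable
    n l : ℕ

select : {P : Fin n → Set} → (∀ v → Dec (P v)) → Subset n
select P? = tabulate (λ v → Dec.isYes (P? v))

∈-select : {P : Fin n → Set} (P? : ∀ v → Dec (P v)) (v : Fin n) →
           v ∈ select P? ⇔ P v
∈-select P? v = mk⇔
  (λ v∈ → Dec.toWitness (Bool.T-≡ .from (membership .to v∈)))
  (λ p → membership .from (Bool.T-≡ .to (Dec.fromWitness p)))
  where
  membership : v ∈ select P? ⇔ (Dec.isYes (P? v) ≡ true)
  membership = mk⇔ (λ v∈ → trans (sym (Vec.lookup∘tabulate _ v)) (Vec.[]=⇒lookup v∈))
                   (λ eq → Vec.lookup⇒[]= v _ (trans (Vec.lookup∘tabulate _ v) eq))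

∈-extensionality : {p q : Subset n} → (∀ v → v ∈ p ⇔ v ∈ q) → p ≡ q
∈-extensionality p≐q = ⊆-antisym (λ {v} → p≐q v .to) (λ {v} → p≐q v .from)

family-exists : {P : Fin l → Fin n → Set} → (∀ i v → Dec (P i v)) →
                ∃ λ (X : Vec (Subset n) l) → ∀ i v → v ∈ lookup X i ⇔ P i v
family-exists P? = tabulate (λ i → select (P? i)) , λ i v →
  subst (λ X → v ∈ X ⇔ _) (sym (Vec.lookup∘tabulate _ i)) (∈-select (P? i) v)

family-unique : {P : Fin l → Fin n → Set} {X Y : Vec (Subset n) l} →
                (∀ i v → v ∈ lookup X i ⇔ P i v) →
                (∀ i v → v ∈ lookup Y i ⇔ P i v) → X ≡ Y
family-unique {X = X} {Y} X-spec Y-spec = begin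
  X                     ≡⟨ Vec.tabulate∘lookup X ⟨
  tabulate (lookup X)   ≡⟨ Vec.tabulate-cong lookup-equal ⟩
  tabulate (lookup Y)   ≡⟨ Vec.tabulate∘lookup Y ⟩
  Y                     ∎
  where
  open ≡-Reasoning
  lookup-equal : ∀ i → lookup X i ≡ lookup Y i
  lookup-equal i = ∈-extensionality λ v → ⇔-trans (X-spec i v) (⇔-sym (Y-spec i v))

_⇔-dec_ : {A B : Set} → Dec A → Dec B → Dec (A ⇔ B)
a? ⇔-dec b? =
  Dec.map′ (λ (f , g) → mk⇔ f g) (λ e → e .to , e .from) ((a? →-dec b?) ×-dec (b? →-dec a?))

x∈p─q⇒x∉q : ∀ (p q : Subset n) {x} → x ∈ p ─ q → x ∉ q
x∈p─q⇒x∉q (_ ∷ p) (inside  ∷ q) {Fin.zero}  ()            _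
x∈p─q⇒x∉q (_ ∷ p) (outside ∷ q) {Fin.zero}  _             ()
x∈p─q⇒x∉q (_ ∷ p) (_       ∷ q) {Fin.suc _} (Vec.there m) (Vec.there m′) = x∈p─q⇒x∉q p q m m′

∈-split : ∀ {p : Subset n} {x} → x ∈ p → ∀ v → v ∈ p ⇔ (v ∈ ⁅ x ⁆ ⊎ v ∈ p - x)
∈-split {p = p} {x} x∈p v = mk⇔ split join
  where
  split : v ∈ p → v ∈ ⁅ x ⁆ ⊎ v ∈ p - x
  split v∈p with v Fin.≟ x
  ... | yes refl = inj₁ (x∈⁅x⁆ v)
  ... | no v≢x   = inj₂ (x∈p∧x≢y⇒x∈p-y v∈p v≢x)
  join : v ∈ ⁅ x ⁆ ⊎ v ∈ p - x → v ∈ p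
  join (inj₁ v∈⁅x⁆) = subst (_∈ p) (sym (x∈⁅y⁆⇒x≡y x v∈⁅x⁆)) x∈p
  join (inj₂ v∈p-x) = p─q⊆p p ⁅ x ⁆ v∈p-x

x∈⁅y⁆⇒x∉p-y : ∀ {p : Subset n} {x y} → x ∈ ⁅ y ⁆ → x ∉ p - y
x∈⁅y⁆⇒x∉p-y {p = p} {y = y} x∈⁅y⁆ x∈p-y = x∈p─q⇒x∉q p ⁅ y ⁆ x∈p-y x∈⁅y⁆

Unique-∷ʳ⇒∉ : ∀ {A : Set} (xs : List A) {x} → Unique (xs ++ [ x ]) → ¬ x ∈ₗ xs
Unique-∷ʳ⇒∉ (_ ∷ xs) (y∉ ∷ _)      (here refl)  = All.lookup y∉ (∈-++⁺ʳ xs (here refl)) refl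
Unique-∷ʳ⇒∉ (_ ∷ xs) (_ ∷ unique) (there x∈xs) = Unique-∷ʳ⇒∉ xs unique x∈xs

module _ (D : Digraph n) where

  Arc? : ∀ u v → Dec (Arc D u v)
  Arc? u v = D u v Bool.≟ true

  Walk-mono : ∀ {S S′ u v} → S ⊆ S′ → Walk D S u v → Walk D S′ u v
  Walk-mono S⊆S′ (edge u∈S v∈S a) = edge (S⊆S′ u∈S) (S⊆S′ v∈S) a
  Walk-mono S⊆S′ (step u∈S a w)   = step (S⊆S′ u∈S) a (Walk-mono S⊆S′ w)

  Acyclic-antimono : ∀ {S S′} → S ⊆ S′ → Acyclic D S′ → Acyclic D S
  Acyclic-antimono S⊆S′ acyclic v cycle = acyclic v (Walk-mono S⊆S′ cycle)

  IsSource : Subset n → Fin n → Set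
  IsSource S s = s ∈ S × (∀ u → u ∈ S → ¬ Arc D u s)

  IsSink : Subset n → Fin n → Set
  IsSink S s = s ∈ S × (∀ u → u ∈ S → ¬ Arc D s u)

  IsSource? : ∀ S s → Dec (IsSource S s)
  IsSource? S s = (s ∈? S) ×-dec Fin.all? (λ u → (u ∈? S) →-dec ¬? (Arc? u s))

  IsSink? : ∀ S s → Dec (IsSink S s)
  IsSink? S s = (s ∈? S) ×-dec Fin.all? (λ u → (u ∈? S) →-dec ¬? (Arc? s u))

  -- Walking backwards along predecessors visits n + 1 vertices, so by
  -- pigeonhole some vertex repeats.
  predecessors⇒cycle : ∀ {S} → Nonempty S → (∀ v → v ∈ S → ∃ λ u → u ∈ S × Arc D u v) →
                       ∃ λ v → Walk D S v v
  predecessors⇒cycle {S} (v₀ , v₀∈S) predecessor =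
    repetition⇒cycle (Fin.pigeonhole (ℕ.n<1+n n) (λ k → x (toℕ k)))
    where
    trail : ℕ → ∃ (_∈ S)
    trail zero    = v₀ , v₀∈S
    trail (suc k) = map₂ proj₁ (predecessor _ (proj₂ (trail k)))

    x : ℕ → Fin n
    x k = proj₁ (trail k)

    arc : ∀ k → Arc D (x (suc k)) (x k)
    arc k = proj₂ (proj₂ (predecessor _ (proj₂ (trail k))))

    walk : ∀ i o → Walk D S (x (suc (o + i))) (x i)
    walk i zero    = edge (proj₂ (trail (suc i))) (proj₂ (trail i)) (arc i)
    walk i (suc o) = step (proj₂ (trail (suc (suc o + i)))) (arc (suc o + i)) (walk i o)

    repetition⇒cycle : (∃₂ λ i j → i Fin.< j × x (toℕ i) ≡ x (toℕ j)) → ∃ λ v → Walk D S v v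
    repetition⇒cycle (i , j , i<j , x[i]≡x[j]) with o , 1+i+o≡j ← ℕ.m≤n⇒∃[o]m+o≡n i<j =
      x (toℕ i) , subst (λ y → Walk D S y (x (toℕ i))) x[1+o+i]≡x[i] (walk (toℕ i) o)
      where
      x[1+o+i]≡x[i] : x (suc (o + toℕ i)) ≡ x (toℕ i)
      x[1+o+i]≡x[i] = trans (cong x (trans (cong suc (ℕ.+-comm o (toℕ i))) 1+i+o≡j)) (sym x[i]≡x[j])

  source-exists : ∀ {S} → Acyclic D S → Nonempty S → ∃ (IsSource S)
  source-exists {S} acyclic nonempty with Fin.any? (IsSource? S)
  ... | yes source = source
  ... | no ¬source = ⊥-elim (acyclic _ (proj₂ (predecessors⇒cycle nonempty predecessor)))
    where
    predecessor : ∀ v → v ∈ S → ∃ λ u → u ∈ S × Arc D u v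
    predecessor v v∈S with Fin.any? (λ u → (u ∈? S) ×-dec Arc? u v)
    ... | yes found = found
    ... | no ¬found = ⊥-elim (¬source (v , v∈S , λ u u∈S a → ¬found (u , u∈S , a)))

  Before-++ˡ : ∀ {xs u v} ys → Before D xs u v → Before D (xs ++ ys) u v
  Before-++ˡ {u = u} ys (as , bs , refl , v∈bs) =
    as , bs ++ ys , List.++-assoc as (u ∷ bs) ys , ∈-++⁺ˡ v∈bs

  Before-++ʳ : ∀ {ys u v} xs → Before D ys u v → Before D (xs ++ ys) u v
  Before-++ʳ {u = u} xs (as , bs , refl , v∈bs) =
    xs ++ as , bs , sym (List.++-assoc xs as (u ∷ bs)) , v∈bs

  Before-++ : ∀ {xs ys u v} → u ∈ₗ xs → v ∈ₗ ys → Before D (xs ++ ys) u v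
  Before-++ {ys = ys} {u} u∈xs v∈ys with as , bs , refl ← ∈-∃++ u∈xs =
    as , bs ++ ys , List.++-assoc as (u ∷ bs) ys , ∈-++⁺ʳ bs v∈ys

  Before-∷ : ∀ {x xs u v} → Before D (x ∷ xs) u v → v ∈ₗ xs
  Before-∷ ([]     , _ , refl , v∈bs) = v∈bs
  Before-∷ (_ ∷ as , _ , refl , v∈bs) = ∈-++⁺ʳ as (there v∈bs)

  Before-∷ʳ : ∀ xs {x u v} → Before D (xs ++ [ x ]) u v → u ∈ₗ xs
  Before-∷ʳ []       ([]        , _  , refl , ())
  Before-∷ʳ []       (_ ∷ []    , _  , ()   , _)
  Before-∷ʳ []       (_ ∷ _ ∷ _ , _  , ()   , _)
  Before-∷ʳ (_ ∷ xs) ([]        , _  , refl , _)    = here refl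
  Before-∷ʳ (_ ∷ xs) (_ ∷ as    , bs , eq   , v∈bs) =
    there (Before-∷ʳ xs (as , bs , List.∷-injectiveʳ eq , v∈bs))

  TopSort-[] : ∀ {S} → Empty S → TopSort D S []
  TopSort-[] empty =
    [] ,
    (λ v → mk⇔ (λ ()) (λ v∈S → ⊥-elim (empty (v , v∈S)))) ,
    λ u _ u∈S → ⊥-elim (empty (u , u∈S))

  TopSort-⁅⁆ : ∀ {s} → ¬ Arc D s s → TopSort D ⁅ s ⁆ [ s ]
  TopSort-⁅⁆ {s} no-loop =
    All.[] ∷ [] ,
    (λ v → mk⇔ (λ { (here refl) → x∈⁅x⁆ v }) (λ v∈⁅s⁆ → here (x∈⁅y⁆⇒x≡y s v∈⁅s⁆))) ,
    λ u v u∈⁅s⁆ v∈⁅s⁆ a →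
      contradiction (subst₂ (Arc D) (x∈⁅y⁆⇒x≡y s u∈⁅s⁆) (x∈⁅y⁆⇒x≡y s v∈⁅s⁆) a) no-loop

  TopSort-++ : ∀ {S S₁ S₂ xs ys} →
               (∀ v → v ∈ S ⇔ (v ∈ S₁ ⊎ v ∈ S₂)) → (∀ v → v ∈ S₁ → v ∉ S₂) →
               (∀ u v → u ∈ S₂ → v ∈ S₁ → ¬ Arc D u v) →
               TopSort D S₁ xs → TopSort D S₂ ys → TopSort D S (xs ++ ys)
  TopSort-++ {S} {S₁} {S₂} {xs} {ys} S≐S₁⊎S₂ disjoint backward
             (unique₁ , ∈₁ , sorted₁) (unique₂ , ∈₂ , sorted₂) =
    Unique.++⁺ unique₁ unique₂ (λ (v∈xs , v∈ys) → disjoint _ (∈₁ _ .to v∈xs) (∈₂ _ .to v∈ys)) ,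
    (λ v → mk⇔
      (λ v∈ → S≐S₁⊎S₂ v .from (Data.Sum.map (∈₁ v .to) (∈₂ v .to) (∈-++⁻ xs v∈)))
      (λ v∈S → [ (λ v∈S₁ → ∈-++⁺ˡ (∈₁ v .from v∈S₁)) , (λ v∈S₂ → ∈-++⁺ʳ xs (∈₂ v .from v∈S₂)) ]′
                 (S≐S₁⊎S₂ v .to v∈S))) ,
    λ u v u∈S v∈S → sorted (S≐S₁⊎S₂ u .to u∈S) (S≐S₁⊎S₂ v .to v∈S)
    where
    sorted : ∀ {u v} → u ∈ S₁ ⊎ u ∈ S₂ → v ∈ S₁ ⊎ v ∈ S₂ → Arc D u v → Before D (xs ++ ys) u v
    sorted (inj₁ u∈S₁) (inj₁ v∈S₁) a = Before-++ˡ ys (sorted₁ _ _ u∈S₁ v∈S₁ a)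
    sorted (inj₁ u∈S₁) (inj₂ v∈S₂) _ = Before-++ (∈₁ _ .from u∈S₁) (∈₂ _ .from v∈S₂)
    sorted (inj₂ u∈S₂) (inj₁ v∈S₁) a = contradiction a (backward _ _ u∈S₂ v∈S₁)
    sorted (inj₂ u∈S₂) (inj₂ v∈S₂) a = Before-++ʳ xs (sorted₂ _ _ u∈S₂ v∈S₂ a)

  TopSort-source-∷ : ∀ {S s xs} → IsSource S s → TopSort D (S - s) xs → TopSort D S (s ∷ xs)
  TopSort-source-∷ {S} {s} (s∈S , no-arc-into) =
    TopSort-++ (∈-split s∈S) (λ _ → x∈⁅y⁆⇒x∉p-y)
      (λ u v u∈S-s v∈⁅s⁆ →
        no-arc-into u (p─q⊆p S ⁅ s ⁆ u∈S-s) ∘ subst (Arc D u) (x∈⁅y⁆⇒x≡y s v∈⁅s⁆))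
      (TopSort-⁅⁆ (no-arc-into s s∈S))

  TopSort-sink-∷ʳ : ∀ {S s xs} → IsSink S s → TopSort D (S - s) xs → TopSort D S (xs ++ [ s ])
  TopSort-sink-∷ʳ {S} {s} (s∈S , no-arc-from) sorted =
    TopSort-++ (λ v → mk⇔ (swap ∘ ∈-split s∈S v .to) (∈-split s∈S v .from ∘ swap))
      (λ _ v∈S-s v∈⁅s⁆ → x∈⁅y⁆⇒x∉p-y v∈⁅s⁆ v∈S-s)
      (λ u v u∈⁅s⁆ v∈S-s →
        no-arc-from v (p─q⊆p S ⁅ s ⁆ v∈S-s) ∘ subst (λ w → Arc D w v) (x∈⁅y⁆⇒x≡y s u∈⁅s⁆))
      sorted (TopSort-⁅⁆ (no-arc-from s s∈S))

  topSort-exists : ∀ {S} → Acyclic D S → ∃ (TopSort D S)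
  topSort-exists {S} = go (⊂-wellFounded S)
    where
    go : ∀ {S} → Acc _⊂_ S → Acyclic D S → ∃ (TopSort D S)
    go {S} (acc smaller) acyclic with nonempty? S
    ... | no empty = [] , TopSort-[] empty
    ... | yes nonempty with s , source ← source-exists acyclic nonempty =
      let xs , sorted = go (smaller (x∈p⇒p-x⊂p (proj₁ source)))
                           (Acyclic-antimono (p─q⊆p S ⁅ s ⁆) acyclic)
      in s ∷ xs , TopSort-source-∷ source sorted

  TopSort-∷⇔IsSource : ∀ {S s} → Acyclic D S → (∃ λ xs → TopSort D S (s ∷ xs)) ⇔ IsSource S s
  TopSort-∷⇔IsSource {S} {s} acyclic = mk⇔
    (λ (_ , unique , ∈S , sorted) →
      ∈S s .to (here refl) ,
      λ u u∈S a →
        Unique.Unique[x∷xs]⇒x∉xs unique (Before-∷ (sorted u s u∈S (∈S s .to (here refl)) a)))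
    (λ source →
      let xs , sorted = topSort-exists (Acyclic-antimono (p─q⊆p S ⁅ s ⁆) acyclic)
      in xs , TopSort-source-∷ source sorted)

  TopSort-∷ʳ⇔IsSink : ∀ {S s} → Acyclic D S → (∃ λ xs → TopSort D S (xs ++ [ s ])) ⇔ IsSink S s
  TopSort-∷ʳ⇔IsSink {S} {s} acyclic = mk⇔
    (λ (xs , unique , ∈S , sorted) →
      let s∈S = ∈S s .to (∈-++⁺ʳ xs (here refl))
      in s∈S , λ u u∈S a → Unique-∷ʳ⇒∉ xs unique (Before-∷ʳ xs (sorted s u s∈S u∈S a)))
    (λ sink →
      let xs , sorted = topSort-exists (Acyclic-antimono (p─q⊆p S ⁅ s ⁆) acyclic)
      in xs , TopSort-sink-∷ʳ sink sorted)

  canonical-exists : ∀ {S} → Acyclic D S → ∃₂ (Canonical D S)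
  canonical-exists {S} = go (⊂-wellFounded S)
    where
    go : ∀ {S} → Acc _⊂_ S → Acyclic D S → ∃₂ (Canonical D S)
    go {S} (acc smaller) acyclic with nonempty? S
    ... | no empty = 0 , [] , done empty
    ... | yes nonempty with s , source ← source-exists acyclic nonempty =
      let l , Z , canonical = go (smaller (p∩q≢∅⇒p─q⊂p S sources shared))
                                 (Acyclic-antimono (p─q⊆p S sources) acyclic)
      in suc l , sources ∷ Z , next nonempty (∈-select (IsSource? S)) canonical
      where
      sources : Subset n
      sources = select (IsSource? S)
      shared : Nonempty (S ∩ sources)
      shared = s , x∈p∩q⁺ (proj₁ source , ∈-select (IsSource? S) s .from source)

  canonical-unique : ∀ {S l l′ Z Z′} → Canonical D S l Z → Canonical D S l′ Z′ →
                     _≡_ {A = ∃ (Vec (Subset n))} (l , Z) (l′ , Z′)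
  canonical-unique (done _)            (done _)            = refl
  canonical-unique (done empty)        (next nonempty _ _) = contradiction nonempty empty
  canonical-unique (next nonempty _ _) (done empty)        = contradiction nonempty empty
  canonical-unique (next {Z = Z₁} _ ∈Z₁ rest) (next {Z = Z₁′} _ ∈Z₁′ rest′)
    with refl ← ∈-extensionality {p = Z₁} {Z₁′} (λ v → ⇔-trans (∈Z₁ v) (⇔-sym (∈Z₁′ v)))
    with refl ← canonical-unique rest rest′
    = refl

module _ (D : Digraph n) (M : Subset n) where

  Consistent⇒Acyclic : Consistent D M → Acyclic D M
  Consistent⇒Acyclic consistent v cycle = consistent v v (Walk-mono D (p⊆p∪q ⁅ v ⁆) cycle)

  Equivalent? : ∀ u v → Dec (Equivalent D M u v)
  Equivalent? u v = Fin.all? λ w → (w ∈? M) →-dec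
    ((Arc? D u w ⇔-dec Arc? D v w) ×-dec (Arc? D w u ⇔-dec Arc? D w v))

  module _ (Z : Vec (Subset n) l) where

    ZEquivalent? : ∀ i v → Dec (ZEquivalent D M Z i v)
    ZEquivalent? i v = Fin.any? λ u → (u ∈? lookup Z i) ×-dec Equivalent? v u

    Conflicting? : ∀ i v → Dec (Conflicting D M Z i v)
    Conflicting? i v =
      Fin.any? (λ w → (w ∈? lookup Z i) ×-dec Arc? D v w) ×-dec
      Fin.any? (λ w → (w ∈? lookup Z i) ×-dec Arc? D w v) ×-dec
      Fin.all? (λ j → (j Fin.<? i) →-dec Fin.all? λ w → (w ∈? lookup Z j) →-dec ¬? (Arc? D v w)) ×-dec
      Fin.all? (λ j → (i Fin.<? j) →-dec Fin.all? λ w → (w ∈? lookup Z j) →-dec ¬? (Arc? D w v))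

    NotZEquivalent : Fin n → Set
    NotZEquivalent v = ∀ i → ¬ ZEquivalent D M Z i v

    UniversalMinus⇔IsSource : Consistent D M → ∀ v →
                      UniversalMinus D M Z v ⇔ (NotZEquivalent v × IsSource D (M ∪ ⁅ v ⁆) v)
    UniversalMinus⇔IsSource consistent v = mk⇔
      (λ (¬equivalent , _ , first) → ¬equivalent , TopSort-∷⇔IsSource D (consistent v) .to first)
      (λ (¬equivalent , source) →
        ¬equivalent , consistent v , TopSort-∷⇔IsSource D (consistent v) .from source)

    UniversalPlus⇔IsSink : Consistent D M → ∀ v →
                     UniversalPlus D M Z v ⇔ (NotZEquivalent v × IsSink D (M ∪ ⁅ v ⁆) v)
    UniversalPlus⇔IsSink consistent v = mk⇔
      (λ (¬equivalent , _ , last) → ¬equivalent , TopSort-∷ʳ⇔IsSink D (consistent v) .to last)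
      (λ (¬equivalent , sink) →
        ¬equivalent , consistent v , TopSort-∷ʳ⇔IsSink D (consistent v) .from sink)

    NotZEquivalent? : ∀ v → Dec (NotZEquivalent v)
    NotZEquivalent? v = Fin.all? λ i → ¬? (ZEquivalent? i v)

    ConflictingOrUniversal : Fin l → Fin n → Set
    ConflictingOrUniversal i v =
        Conflicting D M Z i v
      ⊎ (toℕ i ≡ 0 × UniversalMinus D M Z v)
      ⊎ (suc (toℕ i) ≡ l × UniversalPlus D M Z v)

    ConflictingOrUniversal? : Consistent D M → ∀ i v → Dec (ConflictingOrUniversal i v)
    ConflictingOrUniversal? consistent i v =
      Conflicting? i v ⊎-dec
      ((toℕ i ℕ.≟ 0) ×-dec Dec.map (⇔-sym (UniversalMinus⇔IsSource consistent v))
                                   (NotZEquivalent? v ×-dec IsSource? D _ v)) ⊎-dec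
      ((suc (toℕ i) ℕ.≟ l) ×-dec Dec.map (⇔-sym (UniversalPlus⇔IsSink consistent v))
                                         (NotZEquivalent? v ×-dec IsSink? D _ v))

  MSequence-exists : Consistent D M → ∃ (IsMSequence D M)
  MSequence-exists consistent
    with l , Z , canonical ← canonical-exists D (Consistent⇒Acyclic consistent)
    with X , X-spec ← family-exists (ZEquivalent? Z)
    with Y , Y-spec ← family-exists (ConflictingOrUniversal? Z consistent)
    = (l , X , Y) , Z , canonical , X-spec , Y-spec

  MSequence-unique : ∀ {s s′} → IsMSequence D M s → IsMSequence D M s′ → s ≡ s′
  MSequence-unique {l , _} {_ , _} (_ , canonical , X-spec , Y-spec) (_ , canonical′ , X′-spec , Y′-spec)
    with refl ← canonical-unique D canonical canonical′
    = cong₂ (λ X Y → l , X , Y) (family-unique X-spec X′-spec) (family-unique Y-spec Y′-spec)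

lemma15 : (n : ℕ) (T : Digraph n) (side : Fin n → Bool) (M : Subset n) →
          IsBipartiteTournament T side →
          Consistent T M →
          Σ (Sequence T M) λ s → IsMSequence T M s
            × ((s′ : Sequence T M) → IsMSequence T M s′ → s′ ≡ s)
lemma15 _ T _ M _ consistent =
  let s , is-s = MSequence-exists T M consistent
  in s , is-s , λ s′ is-s′ → MSequence-unique T M is-s′ is-s
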